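{- A connected claw-free graph $G$ has a unique perfect matching if and only if $G\in\mathcal{G}$, where $\mathcal{G}$ is the class of graphs obtained by starting with $K_2$ and iteratively applying the following two operations: Operation 1: add two new vertices $x$ and $y$ and the three new edges $xy$, $xu$, $yu$, where $u$ is a simplicial vertex of the current graph; Operation 2: add two new vertices $x$ and $y$, the new edge $xy$, and new edges between $x$ and all vertices of a set $C$, where $C$ is a non-empty clique of the current graph $H$ such that $N_H(u)\setminus C$ is a clique for every vertex $u\in C$.
   Context: A graph is claw-free if it has no induced $K_{1,3}$. A vertex is simplicial if its neighborhood is a clique. $N_H(u)$ denotes the neighborhood of $u$ in $H$. -}

module Defs where

open import Data.Nat using (ℕ; zero; suc)
open import Data.Fin using (Fin; zero; suc; _≟_)
open import Data.Bool using (Bool; true; false; not)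
open import Data.Product using (Σ; ∃; _×_; _,_)
open import Relation.Nullary using (¬_; does)
open import Relation.Binary.PropositionalEquality using (_≡_)
open import Function.Bundles using (_↔_; Inverse)
open import Function using (const)

Graph : ℕ → Set
Graph n = Fin n → Fin n → Bool

Adj : ∀ {n} → Graph n → Fin n → Fin n → Set
Adj G u v = G u v ≡ true

IsSimple : ∀ {n} → Graph n → Set
IsSimple {n} G = (∀ u v → G u v ≡ G v u) × (∀ u → G u u ≡ false)

data Reach {n} (G : Graph n) : Fin n → Fin n → Set where
  here : ∀ {u} → Reach G u u
  step : ∀ {u w v} → Adj G u w → Reach G w v → Reach G u v

Connected : ∀ {n} → Graph n → Set
Connected {n} G = Fin n × (∀ u v → Reach G u v)

ClawFree : ∀ {n} → Graph n → Set
ClawFree {n} G =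
  ∀ (c a b d : Fin n) → Adj G c a → Adj G c b → Adj G c d →
  ¬ a ≡ b → ¬ a ≡ d → ¬ b ≡ d →
  ¬ (¬ Adj G a b × ¬ Adj G a d × ¬ Adj G b d)

-- A perfect matching, encoded as the map sending each vertex to its
-- partner: a fixed-point-free involution along edges.
record PerfectMatching {n} (G : Graph n) : Set where
  field
    mate     : Fin n → Fin n
    mate-adj : ∀ v → Adj G v (mate v)
    mate-inv : ∀ v → mate (mate v) ≡ v

open PerfectMatching public

UniquePM : ∀ {n} → Graph n → Set
UniquePM G = Σ (PerfectMatching G) λ M →
  ∀ (M' : PerfectMatching G) → ∀ v → mate M' v ≡ mate M v

-- Clique (vertex subsets given by characteristic functions).
IsClique : ∀ {n} → Graph n → (Fin n → Bool) → Set
IsClique {n} G C = ∀ (a b : Fin n) → C a ≡ true → C b ≡ true → ¬ a ≡ b → Adj G a b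

Nbhd : ∀ {n} → Graph n → Fin n → Fin n → Bool
Nbhd G u = G u

Simplicial : ∀ {n} → Graph n → Fin n → Set
Simplicial G u = IsClique G (Nbhd G u)

eqb : ∀ {n} → Fin n → Fin n → Bool
eqb a b = does (a ≟ b)

-- Extend H by two new vertices x (= 0) and y (= 1), edge xy,
-- x adjacent to the set X and y adjacent to the set Y of old vertices;
-- old vertex i becomes suc (suc i).
extend : ∀ {n} → Graph n → (Fin n → Bool) → (Fin n → Bool) → Graph (suc (suc n))
extend H X Y zero zero = false
extend H X Y zero (suc zero) = true
extend H X Y zero (suc (suc j)) = X j
extend H X Y (suc zero) zero = true
extend H X Y (suc zero) (suc zero) = false
extend H X Y (suc zero) (suc (suc j)) = Y j
extend H X Y (suc (suc i)) zero = X i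
extend H X Y (suc (suc i)) (suc zero) = Y i
extend H X Y (suc (suc i)) (suc (suc j)) = H i j

op1 : ∀ {n} → Graph n → Fin n → Graph (suc (suc n))
op1 H u = extend H (eqb u) (eqb u)

op2 : ∀ {n} → Graph n → (Fin n → Bool) → Graph (suc (suc n))
op2 H C = extend H C (const false)

NbhdMinusClique : ∀ {n} → Graph n → (Fin n → Bool) → Fin n → Set
NbhdMinusClique H C u = IsClique H (λ w → Data.Bool._∧_ (H u w) (not (C w)))

K2 : Graph 2
K2 a b = not (eqb a b)

data Built : ∀ {n} → Graph n → Set where
  base : Built K2
  oper1 : ∀ {n} {H : Graph n} → Built H → (u : Fin n) → Simplicial H u →
          Built (op1 H u)
  oper2 : ∀ {n} {H : Graph n} → Built H → (C : Fin n → Bool) →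
          (∃ λ u → C u ≡ true) → IsClique H C →
          (∀ u → C u ≡ true → NbhdMinusClique H C u) →
          Built (op2 H C)

Iso : ∀ {n} → Graph n → Graph n → Set
Iso {n} G H = Σ (Fin n ↔ Fin n) λ f →
  ∀ u v → G u v ≡ H (Inverse.to f u) (Inverse.to f v)

-- The class 𝒢 (closed under isomorphism).
InClassG : ∀ {n} → Graph n → Set
InClassG {n} G = Σ (Graph n) λ H → Built H × Iso G H

module Submission where

-- Both directions peel off the two newest vertices x, y of the last
-- operation.
--
-- (⇐) In op1 H u and op2 H C every perfect matching pairs x with y, so the
--     perfect matchings of the extension are those of H plus the edge xy;
--     uniqueness then propagates along the construction from K₂
--     (built-unique).
-- (⇒) Let M be the unique perfect matching of G.  A graph with a unique
--     perfect matching has no M-alternating cycle.  Growing a maximal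
--     M-alternating path and using claw-freeness at its first vertices we
--     find an edge xy of M such that either y is a pendant vertex at x, or
--     x and y have exactly one common neighbour u and no other neighbours
--     (module UniqueMatching, end-edge).  Relabelling x, y as the vertices
--     0, 1, the graph H = G - x - y is again connected, claw-free and has a
--     unique perfect matching; by induction H ∈ 𝒢, and G is op2 H N(x)
--     (first case) or op1 H u (second case), where claw-freeness supplies
--     the side conditions (module EndAt01, reduce).

open import Defs
open import Data.Nat as Nat using (ℕ; zero; suc; _≤_; _<_; z≤n; s≤s; _+_)
open import Data.Nat.Properties
  using (≤-pred; 1+n≰n; ≤-refl; ≤-trans; <-≤-trans; <-irrefl; ≤∧≢⇒<; n≤1+n; m≤n⇒m<n∨m≡n)
open import Data.Nat.Properties using (+-suc; +-identityʳ)
open import Data.Fin using (Fin; zero; suc; _≟_; toℕ)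
open import Data.Fin.Patterns using (0F; 1F)
open import Data.Fin.Properties using (suc-injective; pigeonhole; toℕ<n; any?)
open import Data.Fin.Permutation as Perm using (Permutation′; _⟨$⟩ʳ_; _⟨$⟩ˡ_; _∘ₚ_; transpose; lift₀)
open import Data.Bool using (Bool; true; false; not; _∧_)
open import Data.Bool.Properties as Boolₚ using (∧-conicalˡ; ∧-conicalʳ)
open import Data.Product using (Σ; ∃; _×_; _,_; proj₁; proj₂)
open import Data.Sum using (_⊎_; inj₁; inj₂) renaming (map to ⊎-map)
open import Data.Empty using (⊥-elim)
open import Function using (case_of_)
open import Function.Bundles using (_⇔_; mk⇔)
open import Relation.Nullary using (¬_; Dec; yes; no)
open import Relation.Nullary.Decidable using (dec-true; dec-false; decidable-stable; _×-dec_; _⊎-dec_)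
open import Relation.Binary.PropositionalEquality

module _ {n} {G : Graph n} (simple : IsSimple G) where

  adj-sym : ∀ {a b} → Adj G a b → Adj G b a
  adj-sym {a} {b} e = trans (proj₁ simple b a) e

  adj-irrefl : ∀ {a b} → Adj G a b → a ≢ b
  adj-irrefl {a} e refl = case trans (sym e) (proj₂ simple a) of λ ()

mate-injective : ∀ {n} {G : Graph n} (M : PerfectMatching G) {a b} →
                 mate M a ≡ mate M b → a ≡ b
mate-injective M {a} {b} e = trans (sym (mate-inv M a)) (trans (cong (mate M) e) (mate-inv M b))

bool-ext : ∀ {a b : Bool} → (a ≡ true → b ≡ true) → (b ≡ true → a ≡ true) → a ≡ b
bool-ext {true}  {true}  _ _ = refl
bool-ext {false} {false} _ _ = refl
bool-ext {true}  {false} f _ = sym (f refl)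
bool-ext {false} {true}  _ g = g refl

true-stable : ∀ b → ¬ ¬ (b ≡ true) → b ≡ true
true-stable b = decidable-stable (b Boolₚ.≟ true)

not-true : ∀ {a : Bool} → not a ≡ true → a ≢ true
not-true {false} _ ()

eqb-refl : ∀ {n} (u : Fin n) → eqb u u ≡ true
eqb-refl u = dec-true (u ≟ u) refl

eqb-sound : ∀ {n} (u v : Fin n) → eqb u v ≡ true → u ≡ v
eqb-sound u v e with u ≟ v
... | yes u≡v = u≡v

eqb-map : ∀ {m n} (f : Fin m → Fin n) → (∀ {i j} → f i ≡ f j → i ≡ j) → ∀ u j → eqb u j ≡ eqb (f u) (f j)
eqb-map f f-injective u j with u ≟ j | f u ≟ f j
... | yes _ | yes _ = refl
... | no _ | no _ = refl
... | yes refl | no fu≢fu = ⊥-elim (fu≢fu refl)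
... | no u≢j | yes fu≡fj = ⊥-elim (u≢j (f-injective fu≡fj))

-- The two ways in which the edge xy of a perfect matching can end a graph
-- of 𝒢: y is a pendant vertex at x (Operation 2), or x and y have the
-- common neighbour u and no other neighbours (Operation 1).
Pendant : ∀ {n} → Graph n → Fin n → Fin n → Set
Pendant G x y = ∀ w → Adj G y w → w ≡ x

Ear : ∀ {n} → Graph n → Fin n → Fin n → Fin n → Set
Ear G x y u = Adj G x u × Adj G y u ×
              (∀ w → Adj G x w → w ≡ y ⊎ w ≡ u) × (∀ w → Adj G y w → w ≡ x ⊎ w ≡ u)

iso-refl : ∀ {n} {A B : Graph n} → (∀ u v → A u v ≡ B u v) → Iso A B
iso-refl A≗B = Perm.id , A≗B

iso-sym : ∀ {n} {A B : Graph n} → Iso A B → Iso B A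
iso-sym {B = B} (π , hom) = Perm.flip π , λ p q →
  trans (cong₂ B (sym (Perm.inverseʳ π)) (sym (Perm.inverseʳ π))) (sym (hom (π ⟨$⟩ˡ p) (π ⟨$⟩ˡ q)))

iso-trans : ∀ {n} {A B C : Graph n} → Iso A B → Iso B C → Iso A C
iso-trans (π , hom) (ρ , hom′) = π ∘ₚ ρ , λ u v → trans (hom u v) (hom′ _ _)

module Transport {n} {A B : Graph n} (π : Permutation′ n)
                 (hom : ∀ u v → A u v ≡ B (π ⟨$⟩ʳ u) (π ⟨$⟩ʳ v)) where

  private
    to : Fin n → Fin n
    to = π ⟨$⟩ʳ_
    from : Fin n → Fin n
    from = π ⟨$⟩ˡ_

  hom⁻ : ∀ p q → B p q ≡ A (from p) (from q)
  hom⁻ = proj₂ (iso-sym (π , hom))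

  to-injective : ∀ {u v} → to u ≡ to v → u ≡ v
  to-injective {u} {v} e = trans (sym (Perm.inverseˡ π)) (trans (cong from e) (Perm.inverseˡ π))

  adj-forth : ∀ {u v} → Adj A u v → Adj B (to u) (to v)
  adj-forth {u} {v} = trans (sym (hom u v))

  adj-back : ∀ {u v} → Adj B (to u) (to v) → Adj A u v
  adj-back {u} {v} = trans (hom u v)

  adj-to : ∀ {p q} → Adj B p q → Adj A (from p) (from q)
  adj-to {p} {q} = trans (sym (hom⁻ p q))

  simple : IsSimple B → IsSimple A
  simple (B-sym , B-loop) =
    (λ u v → trans (hom u v) (trans (B-sym _ _) (sym (hom v u)))) , λ u → trans (hom u u) (B-loop _)

  reach : ∀ {p q} → Reach B p q → Reach A (from p) (from q)
  reach here = here
  reach (step adj r) = step (adj-to adj) (reach r)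

  connected : Connected B → Connected A
  connected (v , walks) = from v , λ u w →
    subst₂ (Reach A) (Perm.inverseˡ π) (Perm.inverseˡ π) (reach (walks (to u) (to w)))

  claw-free : ClawFree B → ClawFree A
  claw-free cf c a b d ca cb cd a≢b a≢d b≢d (¬ab , ¬ad , ¬bd) =
    cf (to c) (to a) (to b) (to d) (adj-forth ca) (adj-forth cb) (adj-forth cd)
       (λ e → a≢b (to-injective e)) (λ e → a≢d (to-injective e)) (λ e → b≢d (to-injective e))
       ((λ e → ¬ab (adj-back e)) , (λ e → ¬ad (adj-back e)) , (λ e → ¬bd (adj-back e)))

  matching : PerfectMatching B → PerfectMatching A
  matching M = record
    { mate     = λ v → from (mate M (to v))
    ; mate-adj = λ v → trans (hom v _) (trans (cong (B (to v)) (Perm.inverseʳ π)) (mate-adj M (to v)))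
    ; mate-inv = λ v → trans (cong (λ z → from (mate M z)) (Perm.inverseʳ π))
                             (trans (cong from (mate-inv M (to v))) (Perm.inverseˡ π))
    }

  matching⁻ : PerfectMatching A → PerfectMatching B
  matching⁻ M = record
    { mate     = λ p → to (mate M (from p))
    ; mate-adj = λ p → trans (hom⁻ p _) (trans (cong (A (from p)) (Perm.inverseˡ π)) (mate-adj M (from p)))
    ; mate-inv = λ p → trans (cong (λ z → to (mate M z)) (Perm.inverseˡ π))
                             (trans (cong to (mate-inv M (from p))) (Perm.inverseʳ π))
    }

  unique-matching : UniquePM B → UniquePM A
  unique-matching (M , unique) = matching M , λ M′ v →
    trans (sym (Perm.inverseˡ π))
      (cong from (trans (cong (λ z → to (mate M′ z)) (sym (Perm.inverseˡ π))) (unique (matching⁻ M′) (to v))))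

  adj-from : ∀ {p w} → Adj A (from p) w → Adj B p (to w)
  adj-from {p} {w} e = subst (λ z → Adj B z (to w)) (Perm.inverseʳ π) (trans (sym (hom (from p) w)) e)

  from-eq : ∀ {w p} → to w ≡ p → w ≡ from p
  from-eq e = trans (sym (Perm.inverseˡ π)) (cong from e)

  pendant : ∀ {x y} → Pendant B x y → Pendant A (from x) (from y)
  pendant y-pendant w y∼w = from-eq (y-pendant (to w) (adj-from y∼w))

  ear : ∀ {x y u} → Ear B x y u → Ear A (from x) (from y) (from u)
  ear (x∼u , y∼u , x-only , y-only) = adj-to x∼u , adj-to y∼u , only x-only , only y-only
    where
    only : ∀ {p q u} → (∀ w → Adj B p w → w ≡ q ⊎ w ≡ u) →
           ∀ w → Adj A (from p) w → w ≡ from q ⊎ w ≡ from u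
    only p-only w p∼w = ⊎-map from-eq from-eq (p-only (to w) (adj-from p∼w))

  clique : ∀ {S S′} → IsClique A S → (∀ p → S′ p ≡ true → S (from p) ≡ true) → IsClique B S′
  clique clq S′⊆S p q p∈ q∈ p≢q =
    trans (hom⁻ p q) (clq (from p) (from q) (S′⊆S p p∈) (S′⊆S q q∈)
      (λ e → p≢q (trans (sym (Perm.inverseʳ π)) (trans (cong to e) (Perm.inverseʳ π)))))

old : ∀ {k} → Fin k → Fin (suc (suc k))
old j = suc (suc j)

old-injective : ∀ {k} {i j : Fin k} → old i ≡ old j → i ≡ j
old-injective e = suc-injective (suc-injective e)

restrict : ∀ {k} → Graph (suc (suc k)) → Graph k
restrict K i j = K (old i) (old j)

extend-restrict : ∀ {k} {K : Graph (suc (suc k))} → IsSimple K → Adj K 0F 1F →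
  ∀ u v → K u v ≡ extend (restrict K) (λ j → K 0F (old j)) (λ j → K 1F (old j)) u v
extend-restrict (K-sym , K-loop) K01 0F 0F = K-loop 0F
extend-restrict (K-sym , K-loop) K01 0F 1F = K01
extend-restrict (K-sym , K-loop) K01 0F (suc (suc j)) = refl
extend-restrict (K-sym , K-loop) K01 1F 0F = trans (K-sym 1F 0F) K01
extend-restrict (K-sym , K-loop) K01 1F 1F = K-loop 1F
extend-restrict (K-sym , K-loop) K01 1F (suc (suc j)) = refl
extend-restrict (K-sym , K-loop) K01 (suc (suc i)) 0F = K-sym _ 0F
extend-restrict (K-sym , K-loop) K01 (suc (suc i)) 1F = K-sym _ 1F
extend-restrict (K-sym , K-loop) K01 (suc (suc i)) (suc (suc j)) = refl

extend-iso : ∀ {k} {H H′ : Graph k} {X Y X′ Y′ : Fin k → Bool} (iso : Iso H H′) →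
  (∀ j → X j ≡ X′ (proj₁ iso ⟨$⟩ʳ j)) → (∀ j → Y j ≡ Y′ (proj₁ iso ⟨$⟩ʳ j)) →
  Iso (extend H X Y) (extend H′ X′ Y′)
extend-iso {H = H} {H′} {X} {Y} {X′} {Y′} (π , hom) X≗ Y≗ = lift₀ (lift₀ π) , hom₂
  where
  hom₂ : ∀ u v → extend H X Y u v ≡ extend H′ X′ Y′ (lift₀ (lift₀ π) ⟨$⟩ʳ u) (lift₀ (lift₀ π) ⟨$⟩ʳ v)
  hom₂ 0F 0F = refl
  hom₂ 0F 1F = refl
  hom₂ 0F (suc (suc j)) = X≗ j
  hom₂ 1F 0F = refl
  hom₂ 1F 1F = refl
  hom₂ 1F (suc (suc j)) = Y≗ j
  hom₂ (suc (suc i)) 0F = X≗ i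
  hom₂ (suc (suc i)) 1F = Y≗ i
  hom₂ (suc (suc i)) (suc (suc j)) = hom i j

lower : ∀ {k} (v : Fin (suc (suc k))) → v ≢ 0F → v ≢ 1F → Fin k
lower 0F v≢0 _ = ⊥-elim (v≢0 refl)
lower 1F _ v≢1 = ⊥-elim (v≢1 refl)
lower (suc (suc j)) _ _ = j

old-lower : ∀ {k} (v : Fin (suc (suc k))) v≢0 v≢1 → old (lower v v≢0 v≢1) ≡ v
old-lower 0F v≢0 _ = ⊥-elim (v≢0 refl)
old-lower 1F _ v≢1 = ⊥-elim (v≢1 refl)
old-lower (suc (suc j)) _ _ = refl

mate-flip : ∀ {n} {G : Graph n} (M : PerfectMatching G) {a b} → mate M a ≡ b → mate M b ≡ a
mate-flip M {a} e = trans (cong (mate M) (sym e)) (mate-inv M a)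

module _ {k} {K : Graph (suc (suc k))} where

  extendPM : Adj K 0F 1F → Adj K 1F 0F → PerfectMatching (restrict K) → PerfectMatching K
  extendPM K01 K10 N = record { mate = partner ; mate-adj = partner-adj ; mate-inv = partner-inv }
    where
    partner : Fin (suc (suc k)) → Fin (suc (suc k))
    partner 0F = 1F
    partner 1F = 0F
    partner (suc (suc i)) = old (mate N i)
    partner-adj : ∀ v → Adj K v (partner v)
    partner-adj 0F = K01
    partner-adj 1F = K10
    partner-adj (suc (suc i)) = mate-adj N i
    partner-inv : ∀ v → partner (partner v) ≡ v
    partner-inv 0F = refl
    partner-inv 1F = refl
    partner-inv (suc (suc i)) = cong old (mate-inv N i)

  module Restriction (M : PerfectMatching K) (m01 : mate M 0F ≡ 1F) where

    private
      mate-old≢0 : ∀ i → mate M (old i) ≢ 0F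
      mate-old≢0 i e = case mate-injective M (trans e (sym (mate-flip M m01))) of λ ()

      mate-old≢1 : ∀ i → mate M (old i) ≢ 1F
      mate-old≢1 i e = case mate-injective M (trans e (sym m01)) of λ ()

    restricted-mate : Fin k → Fin k
    restricted-mate i = lower (mate M (old i)) (mate-old≢0 i) (mate-old≢1 i)

    old-restricted-mate : ∀ i → old (restricted-mate i) ≡ mate M (old i)
    old-restricted-mate i = old-lower _ (mate-old≢0 i) (mate-old≢1 i)

    restrictPM : PerfectMatching (restrict K)
    restrictPM = record
      { mate     = restricted-mate
      ; mate-adj = λ i → trans (cong (K (old i)) (old-restricted-mate i)) (mate-adj M (old i))
      ; mate-inv = λ i → old-injective
          (trans (old-restricted-mate _) (trans (cong (mate M) (old-restricted-mate i)) (mate-inv M (old i))))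
      }

  unique-restrict : (U : UniquePM K) → mate (proj₁ U) 0F ≡ 1F → UniquePM (restrict K)
  unique-restrict (M , unique) m01 = restrictPM , λ N i →
    old-injective (trans (unique (extendPM K01 K10 N) (old i)) (sym (old-restricted-mate i)))
    where
    open Restriction M m01
    K01 : Adj K 0F 1F
    K01 = subst (Adj K 0F) m01 (mate-adj M 0F)
    K10 : Adj K 1F 0F
    K10 = subst (Adj K 1F) (mate-flip M m01) (mate-adj M 1F)

  unique-extend : UniquePM (restrict K) → Adj K 0F 1F → Adj K 1F 0F →
                  (∀ (N : PerfectMatching K) → mate N 0F ≡ 1F) → UniquePM K
  unique-extend (M , unique) K01 K10 forced = extendPM K01 K10 M , agree
    where
    agree : ∀ N v → mate N v ≡ mate (extendPM K01 K10 M) v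
    agree N 0F = forced N
    agree N 1F = mate-flip N (forced N)
    agree N (suc (suc i)) =
      trans (sym (old-restricted-mate i)) (cong old (unique restrictPM i))
      where open Restriction N (forced N)

-- In op2 H C the new vertex 1 is pendant at 0.
op2-forces-01 : ∀ {k} (H : Graph k) C (N : PerfectMatching (op2 H C)) → mate N 0F ≡ 1F
op2-forces-01 H C N = mate-flip N partner-of-1
  where
  partner-of-1 : mate N 1F ≡ 0F
  partner-of-1 with mate N 1F | mate-adj N 1F
  ... | 0F | _ = refl
  ... | 1F | ()
  ... | suc (suc j) | ()

-- In op1 H u both new vertices see only each other and u, and u cannot be
-- the partner of both.
op1-forces-01 : ∀ {k} (H : Graph k) u (N : PerfectMatching (op1 H u)) → mate N 0F ≡ 1F
op1-forces-01 H u N with mate N 1F in e1 | mate-adj N 1F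
... | 0F | _ = mate-flip N e1
... | 1F | ()
... | suc (suc j) | 1∼j with mate N 0F in e0 | mate-adj N 0F
...   | 0F | ()
...   | 1F | _ = case trans (sym (mate-flip N e0)) e1 of λ ()
...   | suc (suc j′) | 0∼j′ = case mate-injective N same-partner of λ ()
  where
  open ≡-Reasoning
  same-partner : mate N 0F ≡ mate N 1F
  same-partner = begin
    mate N 0F  ≡⟨ e0 ⟩
    old j′     ≡⟨ cong old (sym (eqb-sound u j′ 0∼j′)) ⟩
    old u      ≡⟨ cong old (eqb-sound u j 1∼j) ⟩
    old j      ≡⟨ sym e1 ⟩
    mate N 1F  ∎

-- K₂ is the edge 01 added to the empty graph.
K2-unique : UniquePM K2
K2-unique = unique-extend {K = K2} empty-unique refl refl forced
  where
  empty-unique : UniquePM (restrict K2)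
  empty-unique = record { mate = λ () ; mate-adj = λ () ; mate-inv = λ () } , λ _ ()
  forced : ∀ (N : PerfectMatching K2) → mate N 0F ≡ 1F
  forced N with mate N 0F | mate-adj N 0F
  ... | 0F | ()
  ... | 1F | _ = refl

built-unique : ∀ {n} {H : Graph n} → Built H → UniquePM H
built-unique base = K2-unique
built-unique (oper1 {H = H} b u _) = unique-extend (built-unique b) refl refl (op1-forces-01 H u)
built-unique (oper2 {H = H} b C _ _ _) = unique-extend (built-unique b) refl refl (op2-forces-01 H C)

inClass-unique : ∀ {n} {G : Graph n} → InClassG G → UniquePM G
inClass-unique (H , b , (π , hom)) = Transport.unique-matching π hom (built-unique b)

search : ∀ {P : ℕ → Set} → (∀ i → Dec (P i)) →
         ∀ r → (∃ λ i → i ≤ r × P i) ⊎ (∀ {i} → i ≤ r → ¬ P i)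
search P? zero with P? zero
... | yes p = inj₁ (zero , z≤n , p)
... | no ¬p = inj₂ λ { z≤n → ¬p }
search P? (suc r) with P? (suc r)
... | yes p = inj₁ (suc r , ≤-refl , p)
... | no ¬p with search P? r
...   | inj₁ (i , i≤r , p) = inj₁ (i , ≤-trans i≤r (n≤1+n r) , p)
...   | inj₂ none = inj₂ λ i≤ p → case m≤n⇒m<n∨m≡n i≤ of λ
          { (inj₁ (s≤s i≤r)) → none i≤r p
          ; (inj₂ refl) → ¬p p }

module UniqueMatching {n} {G : Graph n} (simple : IsSimple G) (M : PerfectMatching G)
                      (unique : ∀ (M′ : PerfectMatching G) v → mate M′ v ≡ mate M v) where

  μ : Fin n → Fin n
  μ = mate M

  μ-inv : ∀ v → μ (μ v) ≡ v
  μ-inv = mate-inv M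

  μ-injective : ∀ {v w} → μ v ≡ μ w → v ≡ w
  μ-injective = mate-injective M

  μ-irrefl : ∀ v → v ≢ μ v
  μ-irrefl v = adj-irrefl simple (mate-adj M v)

  -- An M-alternating path a₀ μa₀ a₁ μa₁ … a_ℓ μa_ℓ: its 2(ℓ+1) vertices
  -- are distinct, and μaᵢ is adjacent to aᵢ₊₁.
  record AltPath : Set where
    field
      last     : ℕ
      a        : ℕ → Fin n
      distinct : ∀ {i j} → i ≤ last → j ≤ last → a i ≡ a j → i ≡ j
      disjoint : ∀ {i j} → i ≤ last → j ≤ last → a i ≢ μ (a j)
      links    : ∀ {i} → i < last → Adj G (μ (a i)) (a (suc i))

  open AltPath

  OnPath : AltPath → Fin n → Set
  OnPath P v = ∃ λ i → i ≤ last P × (a P i ≡ v ⊎ μ (a P i) ≡ v)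

  OffPath : AltPath → Fin n → Set
  OffPath P v = ∀ {i} → i ≤ last P → ¬ (a P i ≡ v ⊎ μ (a P i) ≡ v)

  locate : ∀ P v → OnPath P v ⊎ OffPath P v
  locate P v = search (λ i → (a P i ≟ v) ⊎-dec (μ (a P i) ≟ v)) (last P)

  path-short : ∀ P → ¬ (n ≤ last P)
  path-short P n≤ with pigeonhole (s≤s n≤) (λ (i : Fin (suc (last P))) → a P (toℕ i))
  ... | i , j , i<j , e = <-irrefl (distinct P (bound i) (bound j) e) i<j
    where
    bound : (i : Fin (suc (last P))) → toℕ i ≤ last P
    bound i = ≤-pred (toℕ<n i)

  -- An alternating cycle: a path with at least two a-vertices whose last
  -- vertex μa_ℓ is adjacent to a₀.  Exchanging matched and unmatched edges
  -- along it yields a perfect matching different from M.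
  module Exchange (P : AltPath) (long : 1 ≤ last P) (closing : Adj G (μ (a P (last P))) (a P 0)) where

    r : ℕ
    r = last P

    prev : ℕ → ℕ
    prev zero = r
    prev (suc i) = i

    next : ℕ → ℕ
    next i with i Nat.≟ r
    ... | yes _ = zero
    ... | no _ = suc i

    prev≤ : ∀ {i} → i ≤ r → prev i ≤ r
    prev≤ {zero} _ = ≤-refl
    prev≤ {suc i} i≤ = ≤-trans (n≤1+n i) i≤

    next≤ : ∀ {i} → i ≤ r → next i ≤ r
    next≤ {i} i≤ with i Nat.≟ r
    ... | yes _ = z≤n
    ... | no i≢r = ≤∧≢⇒< i≤ i≢r

    next-prev : ∀ {i} → i ≤ r → next (prev i) ≡ i
    next-prev {zero} _ with r Nat.≟ r
    ... | yes _ = refl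
    ... | no r≢r = ⊥-elim (r≢r refl)
    next-prev {suc i} i≤ with i Nat.≟ r
    ... | yes refl = ⊥-elim (<-irrefl refl i≤)
    ... | no _ = refl

    prev-next : ∀ {i} → i ≤ r → prev (next i) ≡ i
    prev-next {i} _ with i Nat.≟ r
    ... | yes i≡r = sym i≡r
    ... | no _ = refl

    a∼prev : ∀ {i} → i ≤ r → Adj G (a P i) (μ (a P (prev i)))
    a∼prev {zero} _ = adj-sym simple closing
    a∼prev {suc i} i< = adj-sym simple (links P i<)

    μa∼next : ∀ {i} → i ≤ r → Adj G (μ (a P i)) (a P (next i))
    μa∼next {i} i≤ with i Nat.≟ r
    ... | yes refl = closing
    ... | no i≢r = links P (≤∧≢⇒< i≤ i≢r)

    swapped : Fin n → Fin n
    swapped v with locate P v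
    ... | inj₁ (i , _ , inj₁ _) = μ (a P (prev i))
    ... | inj₁ (i , _ , inj₂ _) = a P (next i)
    ... | inj₂ _ = μ v

    swapped-a : ∀ {i} → i ≤ r → swapped (a P i) ≡ μ (a P (prev i))
    swapped-a {i} i≤ with locate P (a P i)
    ... | inj₁ (j , j≤ , inj₁ e) = cong (λ z → μ (a P (prev z))) (distinct P j≤ i≤ e)
    ... | inj₁ (j , j≤ , inj₂ e) = ⊥-elim (disjoint P i≤ j≤ (sym e))
    ... | inj₂ off = ⊥-elim (off i≤ (inj₁ refl))

    swapped-b : ∀ {i} → i ≤ r → swapped (μ (a P i)) ≡ a P (next i)
    swapped-b {i} i≤ with locate P (μ (a P i))
    ... | inj₁ (j , j≤ , inj₁ e) = ⊥-elim (disjoint P j≤ i≤ e)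
    ... | inj₁ (j , j≤ , inj₂ e) = cong (λ z → a P (next z)) (distinct P j≤ i≤ (μ-injective e))
    ... | inj₂ off = ⊥-elim (off i≤ (inj₂ refl))

    swapped-off : ∀ {v} → OffPath P v → swapped v ≡ μ v
    swapped-off {v} off with locate P v
    ... | inj₁ (j , j≤ , e) = ⊥-elim (off j≤ e)
    ... | inj₂ _ = refl

    μ-off : ∀ {v} → OffPath P v → OffPath P (μ v)
    μ-off {v} off i≤ (inj₁ e) = off i≤ (inj₂ (trans (cong μ e) (μ-inv v)))
    μ-off off i≤ (inj₂ e) = off i≤ (inj₁ (μ-injective e))

    exchanged : PerfectMatching G
    exchanged = record { mate = swapped ; mate-adj = swapped-adj ; mate-inv = swapped-inv }
      where
      swapped-adj : ∀ v → Adj G v (swapped v)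
      swapped-adj v with locate P v
      ... | inj₁ (i , i≤ , inj₁ refl) = a∼prev i≤
      ... | inj₁ (i , i≤ , inj₂ refl) = μa∼next i≤
      ... | inj₂ off = mate-adj M v

      swapped-inv : ∀ v → swapped (swapped v) ≡ v
      swapped-inv v with locate P v
      ... | inj₁ (i , i≤ , inj₁ refl) = begin
            swapped (μ (a P (prev i)))      ≡⟨ swapped-b (prev≤ i≤) ⟩
            a P (next (prev i))             ≡⟨ cong (a P) (next-prev i≤) ⟩
            a P i                           ∎
        where open ≡-Reasoning
      ... | inj₁ (i , i≤ , inj₂ refl) = begin
            swapped (a P (next i))          ≡⟨ swapped-a (next≤ i≤) ⟩
            μ (a P (prev (next i)))         ≡⟨ cong (λ z → μ (a P z)) (prev-next i≤) ⟩
            μ (a P i)                       ∎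
        where open ≡-Reasoning
      ... | inj₂ off = trans (swapped-off (μ-off off)) (μ-inv v)

  -- Hence a graph with a unique perfect matching has no alternating cycle:
  -- the exchanged matching would pair a₀ with μa_ℓ instead of μa₀.
  no-alternating-cycle : ∀ P → 1 ≤ last P → ¬ Adj G (μ (a P (last P))) (a P 0)
  no-alternating-cycle P long closing with distinct P ≤-refl z≤n (μ-injective μaℓ≡μa₀)
    where
    open Exchange P long closing
    μaℓ≡μa₀ : μ (a P (last P)) ≡ μ (a P 0)
    μaℓ≡μa₀ = trans (sym (swapped-a z≤n)) (unique exchanged (a P 0))
  ... | ℓ≡0 = <-irrefl (sym ℓ≡0) long

  prefix : ∀ P j → j ≤ last P → AltPath
  prefix P j j≤ = record
    { last     = j
    ; a        = a P
    ; distinct = λ i≤ k≤ → distinct P (≤-trans i≤ j≤) (≤-trans k≤ j≤)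
    ; disjoint = λ i≤ k≤ → disjoint P (≤-trans i≤ j≤) (≤-trans k≤ j≤)
    ; links    = λ i< → links P (<-≤-trans i< j≤)
    }

  prepend : ∀ P w → Adj G w (a P 0) → OffPath P w → AltPath
  prepend P w w∼a₀ off = record
    { last = suc (last P) ; a = a′ ; distinct = distinct′ ; disjoint = disjoint′ ; links = links′ }
    where
    a′ : ℕ → Fin n
    a′ zero = μ w
    a′ (suc i) = a P i

    distinct′ : ∀ {i j} → i ≤ suc (last P) → j ≤ suc (last P) → a′ i ≡ a′ j → i ≡ j
    distinct′ {zero} {zero} _ _ _ = refl
    distinct′ {zero} {suc j} _ (s≤s j≤) e = ⊥-elim (off j≤ (inj₂ (trans (cong μ (sym e)) (μ-inv w))))
    distinct′ {suc i} {zero} (s≤s i≤) _ e = ⊥-elim (off i≤ (inj₂ (trans (cong μ e) (μ-inv w))))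
    distinct′ {suc i} {suc j} (s≤s i≤) (s≤s j≤) e = cong suc (distinct P i≤ j≤ e)

    disjoint′ : ∀ {i j} → i ≤ suc (last P) → j ≤ suc (last P) → a′ i ≢ μ (a′ j)
    disjoint′ {zero} {zero} _ _ e = μ-irrefl w (sym (trans e (μ-inv w)))
    disjoint′ {zero} {suc j} _ (s≤s j≤) e = off j≤ (inj₁ (sym (μ-injective e)))
    disjoint′ {suc i} {zero} (s≤s i≤) _ e = off i≤ (inj₁ (trans e (μ-inv w)))
    disjoint′ {suc i} {suc j} (s≤s i≤) (s≤s j≤) = disjoint P i≤ j≤

    links′ : ∀ {i} → i < suc (last P) → Adj G (μ (a′ i)) (a′ (suc i))
    links′ {zero} _ = subst (λ z → Adj G z (a P 0)) (sym (μ-inv w)) w∼a₀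
    links′ {suc i} (s≤s i<) = links P i<

  reroute : ∀ P → 1 ≤ last P → Adj G (a P 0) (a P 1) → AltPath
  reroute P 1≤ a₀∼a₁ = record
    { last = last P ; a = a′ ; distinct = distinct′ ; disjoint = disjoint′ ; links = links′ }
    where
    a′ : ℕ → Fin n
    a′ zero = μ (a P 0)
    a′ (suc i) = a P (suc i)

    distinct′ : ∀ {i j} → i ≤ last P → j ≤ last P → a′ i ≡ a′ j → i ≡ j
    distinct′ {zero} {zero} _ _ _ = refl
    distinct′ {zero} {suc j} _ j≤ e = ⊥-elim (disjoint P j≤ z≤n (sym e))
    distinct′ {suc i} {zero} i≤ _ e = ⊥-elim (disjoint P i≤ z≤n e)
    distinct′ {suc i} {suc j} i≤ j≤ e = distinct P i≤ j≤ e

    disjoint′ : ∀ {i j} → i ≤ last P → j ≤ last P → a′ i ≢ μ (a′ j)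
    disjoint′ {zero} {zero} _ _ e = disjoint P z≤n z≤n (sym (trans e (μ-inv _)))
    disjoint′ {zero} {suc j} _ j≤ e = case distinct P z≤n j≤ (μ-injective e) of λ ()
    disjoint′ {suc i} {zero} i≤ _ e = case distinct P i≤ z≤n (trans e (μ-inv _)) of λ ()
    disjoint′ {suc i} {suc j} i≤ j≤ = disjoint P i≤ j≤

    links′ : ∀ {i} → i < last P → Adj G (μ (a′ i)) (a′ (suc i))
    links′ {zero} _ = subst (λ z → Adj G z (a P 1)) (sym (μ-inv _)) a₀∼a₁
    links′ {suc i} i< = links P i<

  -- No alternating cycle through a₀ μa₀ … aᵢ μaᵢ (i ≥ 1): a₀ ≁ μaᵢ.
  start≁μa : ∀ P {i} → 1 ≤ i → i ≤ last P → ¬ Adj G (a P 0) (μ (a P i))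
  start≁μa P {i} 1≤i i≤ a₀∼μaᵢ = no-alternating-cycle (prefix P i i≤) 1≤i (adj-sym simple a₀∼μaᵢ)

  -- If a₀ ∼ a_{j+1}, then μa_j ≁ μa_{j+1}: otherwise
  -- μa_{j+1} a_{j+1} a₀ μa₀ … a_j μa_j would be an alternating cycle.
  μa≁μa : ∀ P j → suc j ≤ last P → Adj G (a P 0) (a P (suc j)) → ¬ Adj G (μ (a P j)) (μ (a P (suc j)))
  μa≁μa P j j<ℓ a₀∼a₍j+1₎ =
    no-alternating-cycle (prepend (prefix P j j≤ℓ) (a P (suc j)) (adj-sym simple a₀∼a₍j+1₎) off) (s≤s z≤n)
    where
    j≤ℓ : j ≤ last P
    j≤ℓ = ≤-trans (n≤1+n j) j<ℓ
    off : OffPath (prefix P j j≤ℓ) (a P (suc j))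
    off i≤j (inj₁ e) = 1+n≰n (subst (_≤ j) (distinct P (≤-trans i≤j j≤ℓ) j<ℓ e) i≤j)
    off i≤j (inj₂ e) = disjoint P j<ℓ (≤-trans i≤j j≤ℓ) (sym e)

  Saturated : AltPath → Set
  Saturated P = ∀ w → Adj G (a P 0) w → OnPath P w

  extendable? : ∀ P → (∃ λ w → Adj G (a P 0) w × OffPath P w) ⊎ Saturated P
  extendable? P with any? (λ w → (G (a P 0) w Boolₚ.≟ true) ×-dec off? w)
    where
    off? : ∀ w → Dec (OffPath P w)
    off? w with locate P w
    ... | inj₁ (i , i≤ , e) = no λ off → off i≤ e
    ... | inj₂ off = yes off
  ... | yes extension = inj₁ extension
  ... | no none = inj₂ saturated
    where
    saturated : Saturated P
    saturated w a₀∼w with locate P w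
    ... | inj₁ on = on
    ... | inj₂ off = ⊥-elim (none (w , a₀∼w , λ {i} → off {i}))

  record EndEdge : Set where
    field
      x y     : Fin n
      matched : μ x ≡ y
      shape   : Pendant G x y ⊎ (∃ λ u → Ear G x y u)

  module _ (claw-free : ClawFree G) where

    -- a₀ ≁ a_{j+2}: otherwise a_{j+2} would centre a claw with leaves
    -- a₀, μa_{j+1}, μa_{j+2}, pairwise non-adjacent by the lemmas above.
    start≁a : ∀ P j → suc (suc j) ≤ last P → ¬ Adj G (a P 0) (a P (suc (suc j)))
    start≁a P j j+2≤ℓ a₀∼a₍j+2₎ =
      claw-free (a P (suc (suc j))) (a P 0) (μ (a P (suc j))) (μ (a P (suc (suc j))))
        (adj-sym simple a₀∼a₍j+2₎) (adj-sym simple (links P j+2≤ℓ)) (mate-adj M _)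
        (disjoint P z≤n j+1≤ℓ) (disjoint P z≤n j+2≤ℓ)
        (λ e → case distinct P j+1≤ℓ j+2≤ℓ (μ-injective e) of λ ())
        (start≁μa P (s≤s z≤n) j+1≤ℓ , start≁μa P (s≤s z≤n) j+2≤ℓ , μa≁μa P (suc j) j+2≤ℓ a₀∼a₍j+2₎)
      where
      j+1≤ℓ : suc j ≤ last P
      j+1≤ℓ = ≤-trans (n≤1+n (suc j)) j+2≤ℓ

    start-neighbour : ∀ P {w} → Adj G (a P 0) w → OnPath P w → w ≡ μ (a P 0) ⊎ (1 ≤ last P × w ≡ a P 1)
    start-neighbour P a₀∼w (zero , _ , inj₁ refl) = ⊥-elim (adj-irrefl simple a₀∼w refl)
    start-neighbour P a₀∼w (suc zero , 1≤ , inj₁ refl) = inj₂ (1≤ , refl)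
    start-neighbour P a₀∼w (suc (suc j) , j+2≤ , inj₁ refl) = ⊥-elim (start≁a P j j+2≤ a₀∼w)
    start-neighbour P a₀∼w (zero , _ , inj₂ refl) = inj₁ refl
    start-neighbour P a₀∼w (suc i , i+1≤ , inj₂ refl) = ⊥-elim (start≁μa P (s≤s z≤n) i+1≤ a₀∼w)

    pendant-start : ∀ P → Saturated P → ¬ (1 ≤ last P × Adj G (a P 0) (a P 1)) → EndEdge
    pendant-start P saturated ¬a₀∼a₁ = record
      { x = μ (a P 0) ; y = a P 0 ; matched = μ-inv _ ; shape = inj₁ only-μa₀ }
      where
      only-μa₀ : Pendant G (μ (a P 0)) (a P 0)
      only-μa₀ w a₀∼w with start-neighbour P a₀∼w (saturated w a₀∼w)
      ... | inj₁ w≡μa₀ = w≡μa₀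
      ... | inj₂ (1≤ , refl) = ⊥-elim (¬a₀∼a₁ (1≤ , a₀∼w))

    rerouted-end : ∀ P (1≤ : 1 ≤ last P) (a₀∼a₁ : Adj G (a P 0) (a P 1)) →
                   Saturated P → Saturated (reroute P 1≤ a₀∼a₁) → EndEdge
    rerouted-end P 1≤ a₀∼a₁ saturated saturated′ = record
      { x = a P 0 ; y = μ (a P 0) ; matched = refl ; shape = shape }
      where
      a₀-neighbours : ∀ w → Adj G (a P 0) w → w ≡ μ (a P 0) ⊎ w ≡ a P 1
      a₀-neighbours w a₀∼w with start-neighbour P a₀∼w (saturated w a₀∼w)
      ... | inj₁ e = inj₁ e
      ... | inj₂ (_ , e) = inj₂ e

      μa₀-neighbours : ∀ w → Adj G (μ (a P 0)) w → w ≡ a P 0 ⊎ w ≡ a P 1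
      μa₀-neighbours w μa₀∼w with start-neighbour (reroute P 1≤ a₀∼a₁) μa₀∼w (saturated′ w μa₀∼w)
      ... | inj₁ e = inj₁ (trans e (μ-inv _))
      ... | inj₂ (_ , e) = inj₂ e

      shape : Pendant G (a P 0) (μ (a P 0)) ⊎ (∃ λ u → Ear G (a P 0) (μ (a P 0)) u)
      shape with G (μ (a P 0)) (a P 1) Boolₚ.≟ true
      ... | yes μa₀∼a₁ = inj₂ (a P 1 , a₀∼a₁ , μa₀∼a₁ , a₀-neighbours , μa₀-neighbours)
      ... | no μa₀≁a₁ = inj₁ λ w μa₀∼w → case μa₀-neighbours w μa₀∼w of λ
              { (inj₁ e) → e ; (inj₂ refl) → ⊥-elim (μa₀≁a₁ μa₀∼w) }

    -- Grow an alternating path at its start (rerouting when stuck) until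
    -- it is stuck for good; the bound n on its length is the fuel.
    grow : ∀ fuel P → n ≤ last P + fuel → EndEdge
    grow zero P n≤ = ⊥-elim (path-short P (subst (n ≤_) (+-identityʳ _) n≤))
    grow (suc fuel) P n≤ with extendable? P
    ... | inj₁ (w , a₀∼w , off) = grow fuel (prepend P w (adj-sym simple a₀∼w) off) (subst (n ≤_) (+-suc _ _) n≤)
    ... | inj₂ saturated with (1 Nat.≤? last P) ×-dec (G (a P 0) (a P 1) Boolₚ.≟ true)
    ...   | no ¬a₀∼a₁ = pendant-start P saturated ¬a₀∼a₁
    ...   | yes (1≤ , a₀∼a₁) with extendable? (reroute P 1≤ a₀∼a₁)
    ...     | inj₁ (w , μa₀∼w , off) =
              grow fuel (prepend (reroute P 1≤ a₀∼a₁) w (adj-sym simple μa₀∼w) off)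
                        (subst (n ≤_) (+-suc _ _) n≤)
    ...     | inj₂ saturated′ = rerouted-end P 1≤ a₀∼a₁ saturated saturated′

    end-edge : Fin n → EndEdge
    end-edge v = grow n single ≤-refl
      where
      single : AltPath
      single = record
        { last = 0 ; a = λ _ → v
        ; distinct = λ { z≤n z≤n _ → refl }
        ; disjoint = λ _ _ → μ-irrefl v
        ; links = λ () }

inClass-iso : ∀ {n} {G G′ : Graph n} → Iso G G′ → InClassG G′ → InClassG G
inClass-iso {G′ = G′} G≅G′ (H , built , G′≅H) = H , built , iso-trans {B = G′} {C = H} G≅G′ G′≅H

-- Operations 1 and 2 may be applied to any member of 𝒢: apply them to
-- the corresponding vertices of the built graph it is isomorphic to.
op1-closed : ∀ {k} {H : Graph k} {u} → InClassG H → Simplicial H u → InClassG (op1 H u)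
op1-closed {H = H} {u} (H′ , built , (π , hom)) simplicial =
  op1 H′ (π ⟨$⟩ʳ u) , oper1 built (π ⟨$⟩ʳ u) (clique simplicial nbhd⊆)
                    , extend-iso (π , hom) singleton singleton
  where
  open Transport {B = H′} π hom
  nbhd⊆ : ∀ p → H′ (π ⟨$⟩ʳ u) p ≡ true → H u (π ⟨$⟩ˡ p) ≡ true
  nbhd⊆ p e = trans (trans (hom u _) (cong (H′ (π ⟨$⟩ʳ u)) (Perm.inverseʳ π))) e
  singleton : ∀ j → eqb u j ≡ eqb (π ⟨$⟩ʳ u) (π ⟨$⟩ʳ j)
  singleton = eqb-map (π ⟨$⟩ʳ_) to-injective u

op2-closed : ∀ {k} {H : Graph k} {C} → InClassG H → (∃ λ u → C u ≡ true) → IsClique H C →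
             (∀ u → C u ≡ true → NbhdMinusClique H C u) → InClassG (op2 H C)
op2-closed {H = H} {C} (H′ , built , (π , hom)) (u , u∈C) C-clique C-local =
  op2 H′ C′ , oper2 built C′ (π ⟨$⟩ʳ u , subst (λ z → C z ≡ true) (sym (Perm.inverseˡ π)) u∈C)
                     (clique C-clique (λ _ e → e)) C′-local
            , extend-iso (π , hom) (λ j → cong C (sym (Perm.inverseˡ π))) (λ _ → refl)
  where
  open Transport {B = H′} π hom
  C′ : _ → Bool
  C′ p = C (π ⟨$⟩ˡ p)
  C′-local : ∀ p → C′ p ≡ true → NbhdMinusClique H′ C′ p
  C′-local p p∈C′ = clique (C-local (π ⟨$⟩ˡ p) p∈C′)
    λ w e → subst (λ z → z ∧ not (C′ w) ≡ true) (hom⁻ p w) e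

transpose-hit : ∀ {n} (i j : Fin n) → transpose i j ⟨$⟩ʳ i ≡ j
transpose-hit i j rewrite dec-true (i ≟ i) refl = refl

transpose-miss : ∀ {n} (i j : Fin n) {k} → k ≢ i → k ≢ j → transpose i j ⟨$⟩ʳ k ≡ k
transpose-miss i j {k} k≢i k≢j rewrite dec-false (k ≟ i) k≢i | dec-false (k ≟ j) k≢j = refl

move-to-front : ∀ {k} (x y : Fin (suc (suc k))) → x ≢ y →
                Σ (Permutation′ (suc (suc k))) λ σ → σ ⟨$⟩ʳ 0F ≡ x × σ ⟨$⟩ʳ 1F ≡ y
move-to-front {k} x y x≢y = τ₂ ∘ₚ τ₁ , σ0 , σ1
  where
  τ₁ : Permutation′ (suc (suc k))
  τ₁ = transpose 0F x
  y′ : Fin (suc (suc k))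
  y′ = τ₁ ⟨$⟩ˡ y
  τ₂ : Permutation′ (suc (suc k))
  τ₂ = transpose 1F y′
  0≢y′ : 0F ≢ y′
  0≢y′ e = x≢y (trans (sym (transpose-hit 0F x)) (trans (cong (τ₁ ⟨$⟩ʳ_) e) (Perm.inverseʳ τ₁)))
  σ0 : τ₁ ⟨$⟩ʳ (τ₂ ⟨$⟩ʳ 0F) ≡ x
  σ0 = trans (cong (τ₁ ⟨$⟩ʳ_) (transpose-miss 1F y′ (λ ()) 0≢y′)) (transpose-hit 0F x)
  σ1 : τ₁ ⟨$⟩ʳ (τ₂ ⟨$⟩ʳ 1F) ≡ y
  σ1 = trans (cong (τ₁ ⟨$⟩ʳ_) (transpose-hit 1F y′)) (Perm.inverseʳ τ₁)

module _ {k} {K : Graph (suc (suc k))} where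

  Attached : Fin k → Set
  Attached j = Adj K 0F (old j) ⊎ Adj K 1F (old j)

  leave : ∀ {w b} → w ≡ 0F ⊎ w ≡ 1F → Reach K w (old b) → ∃ Attached
  leave (inj₁ ()) here
  leave (inj₂ ()) here
  leave _ (step {w = 0F} _ walk) = leave (inj₁ refl) walk
  leave _ (step {w = 1F} _ walk) = leave (inj₂ refl) walk
  leave (inj₁ refl) (step {w = suc (suc j)} 0∼j _) = j , inj₁ 0∼j
  leave (inj₂ refl) (step {w = suc (suc j)} 1∼j _) = j , inj₂ 1∼j

  -- If the attached vertices form a clique, every walk of K between old
  -- vertices can be shortcut to a walk avoiding 0 and 1.
  module _ (K-sym : ∀ u v → K u v ≡ K v u)
           (attached-clique : ∀ {j j′} → Attached j → Attached j′ → j ≢ j′ → Adj (restrict K) j j′) where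

    Resume : Fin k → Fin (suc (suc k)) → Set
    Resume b 0F = ∀ j → Attached j → Reach (restrict K) j b
    Resume b 1F = ∀ j → Attached j → Reach (restrict K) j b
    Resume b (suc (suc i)) = Reach (restrict K) i b

    via-clique : ∀ {b i} → Attached i → Reach (restrict K) i b → ∀ j → Attached j → Reach (restrict K) j b
    via-clique {i = i} i-att walk j j-att with j ≟ i
    ... | yes refl = walk
    ... | no j≢i = step (attached-clique j-att i-att j≢i) walk

    shortcut : ∀ {w b} → Reach K w (old b) → Resume b w
    shortcut here = here
    shortcut (step {0F} {0F} _ walk) = shortcut walk
    shortcut (step {0F} {1F} _ walk) = shortcut walk
    shortcut (step {0F} {suc (suc i)} 0∼i walk) = via-clique (inj₁ 0∼i) (shortcut walk)
    shortcut (step {1F} {0F} _ walk) = shortcut walk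
    shortcut (step {1F} {1F} _ walk) = shortcut walk
    shortcut (step {1F} {suc (suc i)} 1∼i walk) = via-clique (inj₂ 1∼i) (shortcut walk)
    shortcut (step {suc (suc i)} {0F} i∼0 walk) = shortcut walk i (inj₁ (trans (K-sym _ _) i∼0))
    shortcut (step {suc (suc i)} {1F} i∼1 walk) = shortcut walk i (inj₂ (trans (K-sym _ _) i∼1))
    shortcut (step {suc (suc i)} {suc (suc i′)} i∼i′ walk) = step i∼i′ (shortcut walk)

    restrict-connected : Fin k → Connected K → Connected (restrict K)
    restrict-connected o (_ , walks) = o , λ i j → shortcut (walks (old i) (old j))

-- An end edge placed at 01: the graph is an extension of its restriction H,
-- and claw-freeness turns the shape of the end into the side conditions
-- of Operations 1 and 2.
module EndAt01 {k} {K : Graph (suc (suc k))} (simple : IsSimple K) (claw-free : ClawFree K) where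

  H : Graph k
  H = restrict K

  X Y : Fin k → Bool
  X j = K 0F (old j)
  Y j = K 1F (old j)

  H-simple : IsSimple H
  H-simple = (λ i j → proj₁ simple (old i) (old j)) , λ i → proj₂ simple (old i)

  H-claw-free : ClawFree H
  H-claw-free c a b d ca cb cd a≢b a≢d b≢d =
    claw-free (old c) (old a) (old b) (old d) ca cb cd
      (λ e → a≢b (old-injective e)) (λ e → a≢d (old-injective e)) (λ e → b≢d (old-injective e))

  old≢ : ∀ {i j : Fin k} → i ≢ j → old i ≢ old j
  old≢ i≢j e = i≢j (old-injective e)

  -- For u ∈ X, claw-freeness at u with the leaf 0 ∉ N_H(u) makes
  -- N_H(u) \ X a clique.
  outside-clique : ∀ u → X u ≡ true → NbhdMinusClique H X u
  outside-clique u u∈X w z w∈ z∈ w≢z = true-stable _ λ w≁z →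
    claw-free (old u) 0F (old w) (old z) (adj-sym simple u∈X)
      (∧-conicalˡ _ _ w∈) (∧-conicalˡ _ _ z∈) (λ ()) (λ ()) (old≢ w≢z)
      (not-true (∧-conicalʳ _ _ w∈) , not-true (∧-conicalʳ _ _ z∈) , w≁z)

  -- If 1 is pendant at 0, then Y is empty, and claw-freeness at 0 with
  -- the leaf 1 makes X a clique.
  pendant-Y : Pendant K 0F 1F → ∀ j → Y j ≡ false
  pendant-Y pendant j with Y j in e
  ... | false = refl
  ... | true = case pendant (old j) e of λ ()

  pendant-clique : Adj K 0F 1F → Pendant K 0F 1F → IsClique H X
  pendant-clique K01 pendant a b a∈X b∈X a≢b = true-stable _ λ a≁b →
    claw-free 0F 1F (old a) (old b) K01 a∈X b∈X (λ ()) (λ ()) (old≢ a≢b)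
      (no-Y a , no-Y b , a≁b)
    where
    no-Y : ∀ j → ¬ Adj K 1F (old j)
    no-Y j e = case trans (sym (pendant-Y pendant j)) e of λ ()

  singleton-nbhd : ∀ {p q u} → (∀ j → old j ≢ q) → Adj K p (old u) →
                   (∀ w → Adj K p w → w ≡ q ⊎ w ≡ old u) → ∀ j → K p (old j) ≡ eqb u j
  singleton-nbhd {p} {u = u} old≢q p∼u p-only j = bool-ext
    (λ p∼j → case p-only (old j) p∼j of λ
      { (inj₁ e) → ⊥-elim (old≢q j e)
      ; (inj₂ e) → subst (λ z → eqb u z ≡ true) (sym (old-injective e)) (eqb-refl u) })
    (λ e → subst (λ z → Adj K p (old z)) (eqb-sound u j e) p∼u)

  -- In an ear 0, 1 on the old vertex u, both X and Y are {u}, and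
  -- claw-freeness at u with the leaf 0 makes u simplicial in H.
  ear-X : ∀ {u} → Ear K 0F 1F (old u) → ∀ j → X j ≡ eqb u j
  ear-X (0∼u , _ , 0-only , _) = singleton-nbhd (λ _ ()) 0∼u 0-only

  ear-Y : ∀ {u} → Ear K 0F 1F (old u) → ∀ j → Y j ≡ eqb u j
  ear-Y (_ , 1∼u , _ , 1-only) = singleton-nbhd (λ _ ()) 1∼u 1-only

  ear-simplicial : ∀ {u} → Ear K 0F 1F (old u) → Simplicial H u
  ear-simplicial {u} ear w z u∼w u∼z w≢z = true-stable _ λ w≁z →
    claw-free (old u) 0F (old w) (old z) (adj-sym simple (proj₁ ear)) u∼w u∼z (λ ()) (λ ()) (old≢ w≢z)
      (not-X u∼w , not-X u∼z , w≁z)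
    where
    not-X : ∀ {w} → Adj H u w → ¬ Adj K 0F (old w)
    not-X {w} u∼w 0∼w = adj-irrefl H-simple u∼w (eqb-sound u w (trans (sym (ear-X ear w)) 0∼w))

  ear-old : ∀ {u} → Ear K 0F 1F u → ∃ λ u₀ → u ≡ old u₀
  ear-old {0F} (0∼0 , _) = ⊥-elim (adj-irrefl simple 0∼0 refl)
  ear-old {1F} (_ , 1∼1 , _) = ⊥-elim (adj-irrefl simple 1∼1 refl)
  ear-old {suc (suc u₀)} _ = u₀ , refl

  module _ (K01 : Adj K 0F 1F) (o : Fin k) (connected : Connected K) (IH : Connected H → InClassG H) where

    K≅extend : ∀ {X′ Y′} → (∀ j → X j ≡ X′ j) → (∀ j → Y j ≡ Y′ j) → Iso K (extend H X′ Y′)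
    K≅extend {X′} {Y′} X≗ Y≗ =
      iso-trans {B = extend H X Y} {C = extend H X′ Y′} (iso-refl (extend-restrict simple K01))
                (extend-iso {H′ = H} (iso-refl {A = H} (λ _ _ → refl)) X≗ Y≗)

    pendant-end : Pendant K 0F 1F → InClassG K
    pendant-end pendant =
      inClass-iso (K≅extend (λ _ → refl) (pendant-Y pendant))
        (op2-closed (IH H-connected) X-nonempty (pendant-clique K01 pendant) outside-clique)
      where
      attached⊆X : ∀ {j} → Attached {K = K} j → X j ≡ true
      attached⊆X (inj₁ 0∼j) = 0∼j
      attached⊆X {j} (inj₂ 1∼j) = case trans (sym (pendant-Y pendant j)) 1∼j of λ ()

      H-connected : Connected H
      H-connected = restrict-connected {K = K} (proj₁ simple)
        (λ i-att j-att → pendant-clique K01 pendant _ _ (attached⊆X i-att) (attached⊆X j-att)) o connected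

      X-nonempty : ∃ λ j → X j ≡ true
      X-nonempty with leave {K = K} (inj₁ refl) (proj₂ connected 0F (old o))
      ... | j , j-att = j , attached⊆X j-att

    ear-end : ∀ {u} → Ear K 0F 1F (old u) → InClassG K
    ear-end {u} ear =
      inClass-iso (K≅extend (ear-X ear) (ear-Y ear)) (op1-closed (IH H-connected) (ear-simplicial ear))
      where
      attached≡u : ∀ {j} → Attached {K = K} j → j ≡ u
      attached≡u {j} (inj₁ 0∼j) = sym (eqb-sound u j (trans (sym (ear-X ear j)) 0∼j))
      attached≡u {j} (inj₂ 1∼j) = sym (eqb-sound u j (trans (sym (ear-Y ear j)) 1∼j))

      H-connected : Connected H
      H-connected = restrict-connected {K = K} (proj₁ simple)
        (λ i-att j-att i≢j → ⊥-elim (i≢j (trans (attached≡u i-att) (sym (attached≡u j-att))))) o connected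

reduce : ∀ {k} (G : Graph (suc (suc (suc k)))) → IsSimple G → Connected G → ClawFree G → UniquePM G →
         (∀ (H : Graph (suc k)) → IsSimple H → Connected H → ClawFree H → UniquePM H → InClassG H) →
         InClassG G
reduce {k} G simple connected claw-free (M , unique) IH = inClass-iso (iso-sym {A = K} (σ , λ _ _ → refl)) K-in-𝒢
  where
  open UniqueMatching simple M unique using (end-edge; module EndEdge)
  open EndEdge (end-edge claw-free 0F)

  x≢y : x ≢ y
  x≢y = adj-irrefl simple (subst (Adj G x) matched (mate-adj M x))

  σ : Permutation′ (suc (suc (suc k)))
  σ = proj₁ (move-to-front x y x≢y)

  σ0 : σ ⟨$⟩ʳ 0F ≡ x
  σ0 = proj₁ (proj₂ (move-to-front x y x≢y))

  σ1 : σ ⟨$⟩ʳ 1F ≡ y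
  σ1 = proj₂ (proj₂ (move-to-front x y x≢y))

  K : Graph (suc (suc (suc k)))
  K u v = G (σ ⟨$⟩ʳ u) (σ ⟨$⟩ʳ v)

  module K = Transport {A = K} {B = G} σ (λ _ _ → refl)

  from-x : σ ⟨$⟩ˡ x ≡ 0F
  from-x = trans (cong (σ ⟨$⟩ˡ_) (sym σ0)) (Perm.inverseˡ σ)

  from-y : σ ⟨$⟩ˡ y ≡ 1F
  from-y = trans (cong (σ ⟨$⟩ˡ_) (sym σ1)) (Perm.inverseˡ σ)

  K-unique : UniquePM K
  K-unique = K.unique-matching (M , unique)

  K-m01 : mate (proj₁ K-unique) 0F ≡ 1F
  K-m01 = trans (cong (λ z → σ ⟨$⟩ˡ mate M z) σ0)
                (trans (cong (σ ⟨$⟩ˡ_) matched) from-y)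

  K01 : Adj K 0F 1F
  K01 = subst (Adj K 0F) K-m01 (mate-adj (proj₁ K-unique) 0F)

  open EndAt01 (K.simple simple) (K.claw-free claw-free)

  H-in-𝒢 : Connected H → InClassG H
  H-in-𝒢 H-connected = IH H H-simple H-connected H-claw-free (unique-restrict K-unique K-m01)

  K-in-𝒢 : InClassG K
  K-in-𝒢 with shape
  ... | inj₁ pendant =
    pendant-end K01 zero (K.connected connected) H-in-𝒢 (subst₂ (Pendant K) from-x from-y (K.pendant pendant))
  ... | inj₂ (u , ear) = ear-case (subst₂ (λ p q → Ear K p q (σ ⟨$⟩ˡ u)) from-x from-y (K.ear ear))
    where
    ear-case : ∀ {u} → Ear K 0F 1F u → InClassG K
    ear-case ear₀₁ with ear-old ear₀₁
    ... | u₀ , refl = ear-end K01 zero (K.connected connected) H-in-𝒢 ear₀₁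

two-vertices : ∀ {G : Graph 2} → IsSimple G → Adj G 0F 1F → ∀ u v → G u v ≡ K2 u v
two-vertices (_ , G-loop) G01 0F 0F = G-loop 0F
two-vertices (_ , G-loop) G01 0F 1F = G01
two-vertices (G-sym , _) G01 1F 0F = trans (G-sym 1F 0F) G01
two-vertices (_ , G-loop) G01 1F 1F = G-loop 1F

forward : ∀ n (G : Graph n) → IsSimple G → Connected G → ClawFree G → UniquePM G → InClassG G
forward 0 G _ (() , _) _ _
forward 1 G simple _ _ (M , _) with mate M 0F | mate-adj M 0F
... | 0F | 0∼0 = ⊥-elim (adj-irrefl simple 0∼0 refl)
forward 2 G simple _ _ (M , _) with mate M 0F | mate-adj M 0F
... | 0F | 0∼0 = ⊥-elim (adj-irrefl simple 0∼0 refl)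
... | 1F | 0∼1 = K2 , base , iso-refl (two-vertices simple 0∼1)
forward (suc (suc (suc k))) G simple connected claw-free unique =
  reduce G simple connected claw-free unique (forward (suc k))

theorem5 : ∀ (n : ℕ) (G : Graph n) → IsSimple G → Connected G → ClawFree G →
    (UniquePM G ⇔ InClassG G)
theorem5 n G simple connected claw-free = mk⇔ (forward n G simple connected claw-free) inClass-unique
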